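{- Let $\lambda$ be a partition and $\alpha$ a composition. There exists a dual immaculate recording tableau (DIRT) of shape $\lambda$ with row strip shape $\alpha^{rev}$ if and only if $\alpha=\lambda$.
   Context: A partition is a composition with weakly decreasing parts. For $\alpha=(\alpha_1,\dots,\alpha_\ell)$, $\alpha^{rev}=(\alpha_\ell,\dots,\alpha_1)$. Diagrams use the French convention: row $j$ from the bottom has $\alpha_j$ cells; cell $(i,j)$ is in column $i$ and row $j$. For a filling $Q$ using each of $1,\dots,n$ once: a row strip is a maximal sequence of consecutive integers no two of which lie in the same column. The row strip shape is $(\gamma_1,\dots,\gamma_m)$, where $\gamma_i$ is the length of the row strip starting at $\gamma_1+\dots+\gamma_{i-1}+1$. $Q$ is a DIRT if: (1) rows increase left to right; (2) every row strip starts in the leftmost column; (3) the leftmost column increases from top to bottom; (4) whenever $Q(i,j)>Q(i,g)$ with $j>g$, also $Q(i,j)>Q(i+1,g)$, where an empty cell counts as $\infty$. -}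

module Defs where

open import Data.Nat using (ℕ; zero; suc; _+_; _<_; _≤_; _≥_; _>_)
open import Data.List using (List; []; _∷_; map; length; concat; upTo; reverse)
open import Data.Nat.ListAction using (sum)
open import Data.List.Relation.Unary.All using (All)
open import Data.List.Relation.Unary.Linked using (Linked)
open import Data.List.Relation.Binary.Permutation.Propositional using (_↭_)
open import Data.Maybe using (Maybe; just; nothing)
open import Data.Product using (Σ; ∃; _×_; _,_)
open import Relation.Binary.PropositionalEquality using (_≡_)
open import Relation.Nullary using (¬_)

-- Conventions: a diagram/filling is a list of rows, row 0 is the BOTTOM row
-- (French convention).  Columns and rows are 0-indexed here (the paper is
-- 1-indexed); column 0 is the leftmost column.

IsComposition : List ℕ → Set
IsComposition α = All (λ a → 0 < a) α

IsPartition : List ℕ → Set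
IsPartition μ = IsComposition μ × Linked _≥_ μ

nth : {A : Set} → List A → ℕ → Maybe A
nth []       _       = nothing
nth (x ∷ xs) zero    = just x
nth (x ∷ xs) (suc k) = nth xs k

Filling : Set
Filling = List (List ℕ)

-- entry Q i j = content of cell in column i, row j (nothing = empty cell)
entry : Filling → ℕ → ℕ → Maybe ℕ
entry Q i j with nth Q j
... | nothing = nothing
... | just row = nth row i

IsFillingOf : List ℕ → Filling → Set
IsFillingOf μ Q = map length Q ≡ μ × concat Q ↭ map suc (upTo (sum μ))

Col : Filling → ℕ → ℕ → Set
Col Q k c = ∃ λ j → entry Q c j ≡ just k

DistinctCols : Filling → ℕ → ℕ → Set
DistinctCols Q a g = ∀ p q c → a < p → p < q → q ≤ a + g →
  Col Q p c → ¬ Col Q q c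

-- a+g+1 shares a column with one of a+1, ..., a+g (so the strip
-- a+1..a+g cannot be extended)
Blocked : Filling → ℕ → ℕ → Set
Blocked Q a g = ∃ λ p → ∃ λ c → a < p × p ≤ a + g × Col Q p c × Col Q (suc (a + g)) c

-- RowStripsFrom Q n a γ : starting after the entry a, the entries a+1..n are
-- decomposed into maximal row strips of lengths γ (greedily, from the start)
RowStripsFrom : Filling → ℕ → ℕ → List ℕ → Set
RowStripsFrom Q n a []      = a ≡ n
RowStripsFrom Q n a (g ∷ γ) =
  0 < g × DistinctCols Q a g × (a + g < n → Blocked Q a g) ×
  RowStripsFrom Q n (a + g) γ

RowStripShape : Filling → List ℕ → Set
RowStripShape Q γ = RowStripsFrom Q (length (concat Q)) 0 γ

stripStarts : ℕ → List ℕ → List ℕ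
stripStarts a []      = []
stripStarts a (g ∷ γ) = suc a ∷ stripStarts (a + g) γ

RowsIncrease : Filling → Set
RowsIncrease Q = ∀ i j a b → entry Q i j ≡ just a → entry Q (suc i) j ≡ just b → a < b

StripsStartLeft : Filling → Set
StripsStartLeft Q = ∀ γ → RowStripShape Q γ → All (λ s → Col Q s 0) (stripStarts 0 γ)

FirstColumnDecreasingUp : Filling → Set
FirstColumnDecreasingUp Q = ∀ j g a b → g < j → entry Q 0 j ≡ just a → entry Q 0 g ≡ just b → b > a

-- condition (4): Q(i,j) > Q(i,g), j > g  ⇒  Q(i,j) > Q(i+1,g), empty = ∞
TriangleCondition : Filling → Set
TriangleCondition Q = ∀ i j g a b → g < j → entry Q i j ≡ just a → entry Q i g ≡ just b →
  b < a → ∃ λ c → entry Q (suc i) g ≡ just c × c < a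

IsDIRT : Filling → Set
IsDIRT Q = RowsIncrease Q × StripsStartLeft Q × FirstColumnDecreasingUp Q × TriangleCondition Q

-- A strip
-- starting at a + 1 in row j stays in rows j and above: an entry lower down would
-- be preceded, in its row, by a first-column entry inside the strip, and two
-- entries of a strip never share a column.  So the strip occupies distinct columns
-- of rows of length at most λ_j, and has at most λ_j cells.  The first strip starts
-- at 1, hence in the top row, and the same observation shows that each further
-- strip starts exactly one row lower.  Hence the strip lengths are bounded
-- termwise by λ read from top to bottom; both sum to |λ|, so they coincide.  Conversely, the superstandard
-- filling, whose rows read 1, 2, 3, … from the top row down, is a DIRT whose row
-- strips are exactly its rows.

module Submission where

open import Defs
open import Data.Nat using (ℕ; zero; suc; _+_; _<_; _≤_; _≥_; z≤n; s≤s; _≤?_)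
open import Data.Nat.Properties
open import Data.Nat.ListAction using (sum)
open import Data.Nat.ListAction.Properties using (sum-↭)
open import Data.List using (List; []; _∷_; map; length; concat; upTo; reverse; drop; _++_; applyUpTo; applyDownFrom)
open import Data.List.Properties using (length-map; length-++; reverse-applyUpTo; reverse-injective; map-upTo)
open import Data.List.Membership.Propositional using (_∈_)
open import Data.List.Membership.Propositional.Properties using (∈-map⁻; ∈-map⁺; ∈-upTo⁺; ∈-upTo⁻; ∈-concat⁺′; ∈-concat⁻′)
open import Data.List.Relation.Unary.All using (All; []; _∷_)
open import Data.List.Relation.Unary.Any using (here; there)
open import Data.List.Relation.Unary.Linked using (Linked; []; [-]; _∷_)
open import Data.List.Relation.Binary.Pointwise using (Pointwise; []; _∷_)
open import Data.List.Relation.Binary.Permutation.Propositional using (_↭_; ↭-sym; ↭-refl; module PermutationReasoning)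
open import Data.List.Relation.Binary.Permutation.Propositional.Properties using (∈-resp-↭; ↭-reverse; ++⁺ˡ; ++-comm)
open import Data.Maybe using (just; fromMaybe)
open import Data.Maybe.Properties using (just-injective)
open import Data.Fin as Fin using (Fin; toℕ; fromℕ<)
open import Data.Fin.Properties using (toℕ<n; toℕ-fromℕ<; pigeonhole)
open import Data.Product using (∃; ∃₂; _×_; _,_; proj₁; proj₂)
open import Data.Sum using (inj₁; inj₂)
open import Data.Empty using (⊥; ⊥-elim)
open import Relation.Binary.PropositionalEquality using (_≡_; refl; sym; trans; cong; cong₂; subst; subst₂; module ≡-Reasoning)
open import Relation.Nullary using (¬_; yes; no)
open import Relation.Binary using (tri<; tri≈; tri>)
open import Function.Bundles using (_⇔_; mk⇔)

nth-just⇒< : ∀ {A : Set} (xs : List A) i {v} → nth xs i ≡ just v → i < length xs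
nth-just⇒< (x ∷ xs) zero    _ = s≤s z≤n
nth-just⇒< (x ∷ xs) (suc i) e = s≤s (nth-just⇒< xs i e)

<⇒nth-just : ∀ {A : Set} (xs : List A) i → i < length xs → ∃ λ v → nth xs i ≡ just v
<⇒nth-just (x ∷ xs) zero    _         = x , refl
<⇒nth-just (x ∷ xs) (suc i) (s≤s i<n) = <⇒nth-just xs i i<n

nth-map : ∀ {A B : Set} (f : A → B) xs i {v} → nth xs i ≡ just v → nth (map f xs) i ≡ just (f v)
nth-map f (x ∷ xs) zero    refl = refl
nth-map f (x ∷ xs) (suc i) e    = nth-map f xs i e

All-nth : ∀ {A : Set} {P : A → Set} {xs} i {v} → All P xs → nth xs i ≡ just v → P v
All-nth zero    (px ∷ _)  refl = px
All-nth (suc i) (_ ∷ pxs) e    = All-nth i pxs e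

nth⇒∈ : ∀ {A : Set} (xs : List A) i {v} → nth xs i ≡ just v → v ∈ xs
nth⇒∈ (x ∷ xs) zero    refl = here refl
nth⇒∈ (x ∷ xs) (suc i) e    = there (nth⇒∈ xs i e)

∈⇒nth : ∀ {A : Set} {xs : List A} {v} → v ∈ xs → ∃ λ i → nth xs i ≡ just v
∈⇒nth (here refl) = 0 , refl
∈⇒nth (there v∈xs) with i , e ← ∈⇒nth v∈xs = suc i , e

nth-pred : ∀ {A : Set} (xs : List A) i {v} → nth xs (suc i) ≡ just v → ∃ λ u → nth xs i ≡ just u
nth-pred xs i e = <⇒nth-just xs i (<-trans (n<1+n i) (nth-just⇒< xs (suc i) e))

nthOr0 : List ℕ → ℕ → ℕ
nthOr0 xs i = fromMaybe 0 (nth xs i)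

nthOr0-just : ∀ xs i {v} → nth xs i ≡ just v → nthOr0 xs i ≡ v
nthOr0-just xs i e = cong (fromMaybe 0) e

nthOr0-pos⇒< : ∀ xs i → 0 < nthOr0 xs i → i < length xs
nthOr0-pos⇒< (x ∷ xs) zero    _   = s≤s z≤n
nthOr0-pos⇒< (x ∷ xs) (suc i) 0<v = s≤s (nthOr0-pos⇒< xs i 0<v)

All-nthOr0 : ∀ {P : ℕ → Set} {xs} i → All P xs → i < length xs → P (nthOr0 xs i)
All-nthOr0 {xs = xs} i pxs i<n with v , e ← <⇒nth-just xs i i<n =
  subst _ (sym (nthOr0-just xs i e)) (All-nth i pxs e)

nthOr0-antitone : ∀ {xs} → Linked _≥_ xs → ∀ {i k} → i ≤ k → nthOr0 xs k ≤ nthOr0 xs i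
nthOr0-antitone []  _ = z≤n
nthOr0-antitone [-] {zero} {zero}  _ = ≤-refl
nthOr0-antitone [-] {zero} {suc k} _ = z≤n
nthOr0-antitone [-] {suc i} {suc k} _ = z≤n
nthOr0-antitone (_ ∷ xs↓) {zero} {zero} _ = ≤-refl
nthOr0-antitone (y≤x ∷ xs↓) {zero} {suc k} _ = ≤-trans (nthOr0-antitone xs↓ {0} {k} z≤n) y≤x
nthOr0-antitone (_ ∷ xs↓) {suc i} {suc k} (s≤s i≤k) = nthOr0-antitone xs↓ i≤k

applyUpTo-nthOr0 : ∀ xs → applyUpTo (nthOr0 xs) (length xs) ≡ xs
applyUpTo-nthOr0 []       = refl
applyUpTo-nthOr0 (x ∷ xs) = cong (x ∷_) (applyUpTo-nthOr0 xs)

applyDownFrom-nthOr0 : ∀ xs → applyDownFrom (nthOr0 xs) (length xs) ≡ reverse xs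
applyDownFrom-nthOr0 xs = trans (sym (reverse-applyUpTo (nthOr0 xs) (length xs))) (cong reverse (applyUpTo-nthOr0 xs))

length-concat : ∀ {A : Set} (xss : List (List A)) → length (concat xss) ≡ sum (map length xss)
length-concat []         = refl
length-concat (xs ∷ xss) = trans (length-++ xs) (cong (length xs +_) (length-concat xss))

sum≡0⇒[] : ∀ {xs} → All (0 <_) xs → sum xs ≡ 0 → xs ≡ []
sum≡0⇒[] []               _  = refl
sum≡0⇒[] (0<x ∷ _) sum≡0 = ⊥-elim (m<n⇒n≢0 (<-≤-trans 0<x (m≤m+n _ _)) sum≡0)

Pointwise-≤⇒sum-≤ : ∀ {xs ys} → Pointwise _≤_ xs ys → sum xs ≤ sum ys
Pointwise-≤⇒sum-≤ []            = z≤n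
Pointwise-≤⇒sum-≤ (x≤y ∷ xs≤ys) = +-mono-≤ x≤y (Pointwise-≤⇒sum-≤ xs≤ys)

Pointwise-≤∧sum-≡⇒≡ : ∀ {xs ys} → Pointwise _≤_ xs ys → sum xs ≡ sum ys → xs ≡ ys
Pointwise-≤∧sum-≡⇒≡ []                                  _  = refl
Pointwise-≤∧sum-≡⇒≡ {x ∷ xs} {y ∷ ys} (x≤y ∷ xs≤ys) eq =
  cong₂ _∷_ x≡y (Pointwise-≤∧sum-≡⇒≡ xs≤ys (+-cancelˡ-≡ x _ _ (trans eq (cong (_+ sum ys) (sym x≡y)))))
  where
  open ≤-Reasoning
  x≡y : x ≡ y
  x≡y = ≤-antisym x≤y (+-cancelʳ-≤ (sum ys) y x (begin
    y + sum ys ≡⟨ sym eq ⟩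
    x + sum xs ≤⟨ +-monoʳ-≤ x (Pointwise-≤⇒sum-≤ xs≤ys) ⟩
    x + sum ys ∎))

pigeonhole-≤ : ∀ {m n} (R : ℕ → ℕ → Set) → (∀ t → t < n → ∃ λ c → c < m × R t c) →
  (∀ s t c → s < t → t < n → R s c → R t c → ⊥) → n ≤ m
pigeonhole-≤ {m} {n} R choice unique with n ≤? m
... | yes n≤m = n≤m
... | no n≰m = ⊥-elim (collision (pigeonhole (≰⇒> n≰m) choose))
  where
  choose : Fin n → Fin m
  choose t = fromℕ< (proj₁ (proj₂ (choice (toℕ t) (toℕ<n t))))
  related : ∀ t → R (toℕ t) (toℕ (choose t))
  related t = subst (R (toℕ t)) (sym (toℕ-fromℕ< _)) (proj₂ (proj₂ (choice (toℕ t) (toℕ<n t))))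
  collision : (∃₂ λ s t → s Fin.< t × choose s ≡ choose t) → ⊥
  collision (s , t , s<t , same) =
    unique (toℕ s) (toℕ t) (toℕ (choose t)) s<t (toℕ<n t)
      (subst (λ c → R (toℕ s) (toℕ c)) same (related s)) (related t)

-- Cells of fillings

entry⇒nth : ∀ Q {i j v} → entry Q i j ≡ just v → ∃ λ r → nth Q j ≡ just r × nth r i ≡ just v
entry⇒nth Q {i} {j} e with nth Q j
... | just r = r , refl , e

nth⇒entry : ∀ Q {i j r v} → nth Q j ≡ just r → nth r i ≡ just v → entry Q i j ≡ just v
nth⇒entry Q {i} {j} Qj≡r ri≡v with nth Q j
nth⇒entry Q refl ri≡v | just r = ri≡v

entry⇒∈ : ∀ Q {i j v} → entry Q i j ≡ just v → v ∈ concat Q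
entry⇒∈ Q {i} {j} e with r , Qj≡r , ri≡v ← entry⇒nth Q e =
  ∈-concat⁺′ (nth⇒∈ r i ri≡v) (nth⇒∈ Q j Qj≡r)

∈⇒entry : ∀ Q {v} → v ∈ concat Q → ∃₂ λ i j → entry Q i j ≡ just v
∈⇒entry Q v∈Q
  with r , v∈r , r∈Q ← ∈-concat⁻′ Q v∈Q
  with i , ri≡v ← ∈⇒nth v∈r
  with j , Qj≡r ← ∈⇒nth r∈Q
  = i , j , nth⇒entry Q Qj≡r ri≡v

left-neighbour : ∀ Q {i j v} → entry Q (suc i) j ≡ just v → ∃ λ u → entry Q i j ≡ just u
left-neighbour Q {i} e
  with r , Qj≡r , r[i+1]≡v ← entry⇒nth Q e
  with u , ri≡u ← nth-pred r i r[i+1]≡v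
  = u , nth⇒entry Q Qj≡r ri≡u

rowLength : Filling → ℕ → ℕ
rowLength Q = nthOr0 (map length Q)

entry⇒<rowLength : ∀ Q {i j v} → entry Q i j ≡ just v → i < rowLength Q j
entry⇒<rowLength Q {i} {j} e with r , Qj≡r , ri≡v ← entry⇒nth Q e =
  subst (i <_) (sym (nthOr0-just (map length Q) j (nth-map length Q j Qj≡r))) (nth-just⇒< r i ri≡v)

rowLength-pos⇒entry : ∀ Q {j} → 0 < rowLength Q j → ∃ λ c → entry Q 0 j ≡ just c
rowLength-pos⇒entry Q {j} 0<len
  with r , Qj≡r ← <⇒nth-just Q j (subst (j <_) (length-map length Q) (nthOr0-pos⇒< (map length Q) j 0<len))
  = head-entry r Qj≡r (subst (0 <_) (nthOr0-just (map length Q) j (nth-map length Q j Qj≡r)) 0<len)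
  where
  head-entry : ∀ r → nth Q j ≡ just r → 0 < length r → ∃ λ c → entry Q 0 j ≡ just c
  head-entry (c ∷ _) Qj≡r _ = c , nth⇒entry Q Qj≡r refl

rowLengths-downward : ∀ Q → applyDownFrom (rowLength Q) (length Q) ≡ reverse (map length Q)
rowLengths-downward Q = subst (λ k → applyDownFrom (rowLength Q) k ≡ reverse (map length Q))
  (length-map length Q) (applyDownFrom-nthOr0 (map length Q))

-- Row strips

rowStrips-sum : ∀ {Q n a} γ → RowStripsFrom Q n a γ → a + sum γ ≡ n
rowStrips-sum {a = a} []      a≡n               = trans (+-identityʳ a) a≡n
rowStrips-sum {a = a} (g ∷ γ) (_ , _ , _ , rest) = trans (sym (+-assoc a g (sum γ))) (rowStrips-sum γ rest)

rowStrips-start-≤ : ∀ {Q n a} γ → RowStripsFrom Q n a γ → a ≤ n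
rowStrips-start-≤ {a = a} γ strips = subst (a ≤_) (rowStrips-sum γ strips) (m≤m+n a (sum γ))

rowStrips-nonempty : ∀ {Q n a g} γ → RowStripsFrom Q n a (g ∷ γ) → a < n
rowStrips-nonempty {a = a} γ (0<g , _ , _ , rest) = <-≤-trans (m<m+n a 0<g) (rowStrips-start-≤ γ rest)

blocked⇒¬distinct : ∀ {Q a g h} → Blocked Q a g → g < h → ¬ DistinctCols Q a h
blocked⇒¬distinct {a = a} {g} (p , c , a<p , p≤a+g , p∈c , next∈c) g<h distinct =
  distinct p (suc (a + g)) c a<p (s≤s p≤a+g) (+-monoʳ-< a g<h) p∈c next∈c

shorter-strip-absurd : ∀ {Q n a g h} γ δ →
  RowStripsFrom Q n a (g ∷ γ) → RowStripsFrom Q n a (h ∷ δ) → g < h → ⊥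
shorter-strip-absurd {Q} {a = a} γ δ (_ , _ , blocked , _) (_ , distinct , _ , rest) g<h =
  blocked⇒¬distinct {Q} (blocked (<-≤-trans (+-monoʳ-< a g<h) (rowStrips-start-≤ δ rest))) g<h distinct

rowStrips-unique : ∀ {Q n a} γ δ → RowStripsFrom Q n a γ → RowStripsFrom Q n a δ → γ ≡ δ
rowStrips-unique []      []      _   _   = refl
rowStrips-unique []      (h ∷ δ) a≡n strips = ⊥-elim (<-irrefl a≡n (rowStrips-nonempty δ strips))
rowStrips-unique (g ∷ γ) []      strips a≡n = ⊥-elim (<-irrefl a≡n (rowStrips-nonempty γ strips))
rowStrips-unique (g ∷ γ) (h ∷ δ) strips@(_ , _ , _ , rest) strips′@(_ , _ , _ , rest′) with <-cmp g h
... | tri< g<h _ _  = ⊥-elim (shorter-strip-absurd γ δ strips strips′ g<h)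
... | tri≈ _ refl _ = cong (g ∷_) (rowStrips-unique γ δ rest rest′)
... | tri> _ _ h<g  = ⊥-elim (shorter-strip-absurd δ γ strips′ strips h<g)

-- The superstandard filling

consecutive : ℕ → ℕ → List ℕ
consecutive s zero    = []
consecutive s (suc k) = s ∷ consecutive (suc s) k

length-consecutive : ∀ s k → length (consecutive s k) ≡ k
length-consecutive s zero    = refl
length-consecutive s (suc k) = cong suc (length-consecutive (suc s) k)

consecutive-++ : ∀ s k l → consecutive s (k + l) ≡ consecutive s k ++ consecutive (s + k) l
consecutive-++ s zero    l = cong (λ t → consecutive t l) (sym (+-identityʳ s))
consecutive-++ s (suc k) l rewrite +-suc s k = cong (s ∷_) (consecutive-++ (suc s) k l)

applyUpTo-consecutive : ∀ {f} s k → (∀ i → f i ≡ s + i) → applyUpTo f k ≡ consecutive s k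
applyUpTo-consecutive     s zero    _    = refl
applyUpTo-consecutive {f} s (suc k) f≗s+ =
  cong₂ _∷_ (trans (f≗s+ 0) (+-identityʳ s))
            (applyUpTo-consecutive (suc s) k (λ i → trans (f≗s+ (suc i)) (+-suc s i)))

nth-consecutive⇒ : ∀ s k c {v} → nth (consecutive s k) c ≡ just v → c < k × v ≡ s + c
nth-consecutive⇒ s (suc k) zero    refl = s≤s z≤n , sym (+-identityʳ s)
nth-consecutive⇒ s (suc k) (suc c) e with c<k , v≡ ← nth-consecutive⇒ (suc s) k c e =
  s≤s c<k , trans v≡ (sym (+-suc s c))

<⇒nth-consecutive : ∀ s k c → c < k → nth (consecutive s k) c ≡ just (s + c)
<⇒nth-consecutive s (suc k) zero    _         = cong just (sym (+-identityʳ s))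
<⇒nth-consecutive s (suc k) (suc c) (s≤s c<k) =
  trans (<⇒nth-consecutive (suc s) k c c<k) (cong just (sym (+-suc s c)))

superstandard : List ℕ → Filling
superstandard []      = []
superstandard (x ∷ μ) = consecutive (suc (sum μ)) x ∷ superstandard μ

map-length-superstandard : ∀ μ → map length (superstandard μ) ≡ μ
map-length-superstandard []      = refl
map-length-superstandard (x ∷ μ) = cong₂ _∷_ (length-consecutive (suc (sum μ)) x) (map-length-superstandard μ)

concat-superstandard : ∀ μ → concat (superstandard μ) ↭ map suc (upTo (sum μ))
concat-superstandard []      = ↭-refl
concat-superstandard (x ∷ μ) = begin
  consecutive (1 + sum μ) x ++ concat (superstandard μ) ↭⟨ ++⁺ˡ (consecutive (1 + sum μ) x) (concat-superstandard μ) ⟩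
  consecutive (1 + sum μ) x ++ map suc (upTo (sum μ))   ≡⟨ cong (consecutive (1 + sum μ) x ++_) (map-suc-upTo (sum μ)) ⟩
  consecutive (1 + sum μ) x ++ consecutive 1 (sum μ)    ↭⟨ ++-comm (consecutive (1 + sum μ) x) (consecutive 1 (sum μ)) ⟩
  consecutive 1 (sum μ) ++ consecutive (1 + sum μ) x    ≡⟨ sym (consecutive-++ 1 (sum μ) x) ⟩
  consecutive 1 (sum μ + x)                             ≡⟨ cong (consecutive 1) (+-comm (sum μ) x) ⟩
  consecutive 1 (x + sum μ)                             ≡⟨ sym (map-suc-upTo (x + sum μ)) ⟩
  map suc (upTo (x + sum μ))                            ∎
  where
  open PermutationReasoning
  map-suc-upTo : ∀ k → map suc (upTo k) ≡ consecutive 1 k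
  map-suc-upTo k = trans (map-upTo suc k) (applyUpTo-consecutive 1 k (λ _ → refl))

cellsFrom : List ℕ → ℕ → ℕ
cellsFrom μ k = sum (drop k μ)

cellsFrom-nth : ∀ μ k {x} → nth μ k ≡ just x → cellsFrom μ (suc k) + x ≡ cellsFrom μ k
cellsFrom-nth (x ∷ μ) zero    refl = +-comm (sum μ) x
cellsFrom-nth (_ ∷ μ) (suc k) e    = cellsFrom-nth μ k e

cellsFrom-antitone : ∀ μ {k l} → k ≤ l → cellsFrom μ l ≤ cellsFrom μ k
cellsFrom-antitone μ       {zero}  {zero}  _         = ≤-refl
cellsFrom-antitone []      {zero}  {suc l} _         = z≤n
cellsFrom-antitone (x ∷ μ) {zero}  {suc l} _         =
  ≤-trans (cellsFrom-antitone μ {0} {l} z≤n) (m≤n+m (sum μ) x)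
cellsFrom-antitone []      {suc k} {suc l} _         = z≤n
cellsFrom-antitone (_ ∷ μ) {suc k} {suc l} (s≤s k≤l) = cellsFrom-antitone μ k≤l

cellsFrom-length : ∀ μ → cellsFrom μ (length μ) ≡ 0
cellsFrom-length []      = refl
cellsFrom-length (_ ∷ μ) = cellsFrom-length μ

cellsFrom-intervals-disjoint : ∀ μ {j j′ v} → cellsFrom μ (suc j) < v → v ≤ cellsFrom μ j →
  cellsFrom μ (suc j′) < v → v ≤ cellsFrom μ j′ → j ≡ j′
cellsFrom-intervals-disjoint μ {j} {j′} above below above′ below′ with <-cmp j j′
... | tri< j<j′ _ _  = ⊥-elim (<⇒≱ above (≤-trans below′ (cellsFrom-antitone μ j<j′)))
... | tri≈ _ j≡j′ _ = j≡j′
... | tri> _ _ j′<j  = ⊥-elim (<⇒≱ above′ (≤-trans below (cellsFrom-antitone μ j′<j)))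

nth-superstandard⇒ : ∀ μ j {r} → nth (superstandard μ) j ≡ just r →
  ∃ λ x → nth μ j ≡ just x × r ≡ consecutive (suc (cellsFrom μ (suc j))) x
nth-superstandard⇒ (x ∷ μ) zero    refl = x , refl , refl
nth-superstandard⇒ (_ ∷ μ) (suc j) e    = nth-superstandard⇒ μ j e

nth⇒nth-superstandard : ∀ μ j {x} → nth μ j ≡ just x →
  nth (superstandard μ) j ≡ just (consecutive (suc (cellsFrom μ (suc j))) x)
nth⇒nth-superstandard (x ∷ μ) zero    refl = refl
nth⇒nth-superstandard (_ ∷ μ) (suc j) e    = nth⇒nth-superstandard μ j e

entry-superstandard⇒ : ∀ μ c j {v} → entry (superstandard μ) c j ≡ just v →
  ∃ λ x → nth μ j ≡ just x × c < x × v ≡ suc (cellsFrom μ (suc j) + c)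
entry-superstandard⇒ μ c j e
  with r , Qj≡r , rc≡v ← entry⇒nth (superstandard μ) e
  with x , μj≡x , refl ← nth-superstandard⇒ μ j Qj≡r
  with c<x , v≡ ← nth-consecutive⇒ (suc (cellsFrom μ (suc j))) x c rc≡v
  = x , μj≡x , c<x , v≡

superstandard-entry : ∀ μ c j {x} → nth μ j ≡ just x → c < x →
  entry (superstandard μ) c j ≡ just (suc (cellsFrom μ (suc j) + c))
superstandard-entry μ c j μj≡x c<x =
  nth⇒entry (superstandard μ) (nth⇒nth-superstandard μ j μj≡x) (<⇒nth-consecutive _ _ c c<x)

lower-rows-larger : ∀ μ {g j x} → g < j → nth μ j ≡ just x → cellsFrom μ (suc j) + x ≤ cellsFrom μ (suc g)
lower-rows-larger μ {j = j} g<j μj≡x =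
  ≤-trans (≤-reflexive (cellsFrom-nth μ j μj≡x)) (cellsFrom-antitone μ g<j)

entry-superstandard-range : ∀ μ c j {v} → entry (superstandard μ) c j ≡ just v →
  cellsFrom μ (suc j) < v × v ≤ cellsFrom μ j
entry-superstandard-range μ c j e with x , μj≡x , c<x , refl ← entry-superstandard⇒ μ c j e =
  s≤s (m≤m+n _ c) , ≤-trans (+-monoʳ-< (cellsFrom μ (suc j)) c<x) (≤-reflexive (cellsFrom-nth μ j μj≡x))

superstandard-size : ∀ μ → length (concat (superstandard μ)) ≡ sum μ
superstandard-size μ = trans (length-concat (superstandard μ)) (cong sum (map-length-superstandard μ))

superstandard-rowsIncrease : ∀ μ → RowsIncrease (superstandard μ)
superstandard-rowsIncrease μ i j a b ea eb
  with _ , _ , _ , refl ← entry-superstandard⇒ μ i j ea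
  with _ , _ , _ , refl ← entry-superstandard⇒ μ (suc i) j eb
  = s≤s (+-monoʳ-< (cellsFrom μ (suc j)) (n<1+n i))

superstandard-columns-increase-downward : ∀ μ {c j g a b} → g < j →
  entry (superstandard μ) c j ≡ just a → entry (superstandard μ) c g ≡ just b → a < b
superstandard-columns-increase-downward μ {c} {j} {g} g<j ea eb
  with x , μj≡x , c<x , refl ← entry-superstandard⇒ μ c j ea
  with _ , _ , _ , refl ← entry-superstandard⇒ μ c g eb
  = s≤s (<-≤-trans (+-monoʳ-< (cellsFrom μ (suc j)) c<x) (≤-trans (lower-rows-larger μ g<j μj≡x) (m≤m+n _ c)))

superstandard-firstColumn : ∀ μ → FirstColumnDecreasingUp (superstandard μ)
superstandard-firstColumn μ j g a b g<j = superstandard-columns-increase-downward μ g<j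

superstandard-triangle : ∀ μ → TriangleCondition (superstandard μ)
superstandard-triangle μ i j g a b g<j ea eb b<a =
  ⊥-elim (<-asym b<a (superstandard-columns-increase-downward μ g<j ea eb))

superstandard-row-distinct : ∀ μ j {x} → nth μ j ≡ just x →
  DistinctCols (superstandard μ) (cellsFrom μ (suc j)) x
superstandard-row-distinct μ j {x} μj≡x p q c above p<q q≤end (jp , ep) (jq , eq) =
  <-irrefl (just-injective (trans (sym (inRow above (<⇒≤ (<-≤-trans p<q q≤end)) ep))
                                  (inRow (<-trans above p<q) q≤end eq))) p<q
  where
  inRow : ∀ {v j′} → cellsFrom μ (suc j) < v → v ≤ cellsFrom μ (suc j) + x →
    entry (superstandard μ) c j′ ≡ just v → entry (superstandard μ) c j ≡ just v
  inRow {v} {j′} above′ v≤end e with above″ , below ← entry-superstandard-range μ c j′ e =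
    subst (λ k → entry (superstandard μ) c k ≡ just v)
      (cellsFrom-intervals-disjoint μ above″ below above′ (≤-trans v≤end (≤-reflexive (cellsFrom-nth μ j μj≡x))))
      e

superstandard-rowStart : ∀ μ → IsComposition μ → ∀ j {x} → nth μ j ≡ just x →
  Col (superstandard μ) (suc (cellsFrom μ (suc j))) 0
superstandard-rowStart μ μ-pos j μj≡x =
  j , trans (superstandard-entry μ 0 j μj≡x (All-nth j μ-pos μj≡x))
            (cong (λ t → just (suc t)) (+-identityʳ _))

superstandard-row-blocked : ∀ μ → IsComposition μ → ∀ k {x} → nth μ k ≡ just x →
  cellsFrom μ (suc k) + x < length (concat (superstandard μ)) →
  Blocked (superstandard μ) (cellsFrom μ (suc k)) x
superstandard-row-blocked μ μ-pos zero μ0≡x end<n =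
  ⊥-elim (<-irrefl (trans (cellsFrom-nth μ 0 μ0≡x) (sym (superstandard-size μ))) end<n)
superstandard-row-blocked μ μ-pos (suc k) μk≡x _ with x′ , μk′≡x′ ← nth-pred μ k μk≡x =
  suc (cellsFrom μ (suc (suc k))) , 0 , n<1+n _ , m<m+n _ (All-nth (suc k) μ-pos μk≡x) ,
  superstandard-rowStart μ μ-pos (suc k) μk≡x ,
  subst (λ a → Col (superstandard μ) (suc a) 0) (sym (cellsFrom-nth μ (suc k) μk≡x))
    (superstandard-rowStart μ μ-pos k μk′≡x′)

superstandard-strips : ∀ μ → IsComposition μ → ∀ k → k ≤ length μ →
  RowStripsFrom (superstandard μ) (length (concat (superstandard μ)))
                (cellsFrom μ k) (applyDownFrom (nthOr0 μ) k)
superstandard-strips μ μ-pos zero    _      = sym (superstandard-size μ)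
superstandard-strips μ μ-pos (suc k) k<len
  with x , μk≡x ← <⇒nth-just μ k k<len rewrite nthOr0-just μ k μk≡x =
  All-nth k μ-pos μk≡x , superstandard-row-distinct μ k μk≡x , superstandard-row-blocked μ μ-pos k μk≡x ,
  subst (λ a → RowStripsFrom (superstandard μ) _ a (applyDownFrom (nthOr0 μ) k)) (sym (cellsFrom-nth μ k μk≡x))
    (superstandard-strips μ μ-pos k (<⇒≤ k<len))

superstandard-stripStarts : ∀ μ → IsComposition μ → ∀ k → k ≤ length μ →
  All (λ s → Col (superstandard μ) s 0) (stripStarts (cellsFrom μ k) (applyDownFrom (nthOr0 μ) k))
superstandard-stripStarts μ μ-pos zero    _      = []
superstandard-stripStarts μ μ-pos (suc k) k<len
  with x , μk≡x ← <⇒nth-just μ k k<len rewrite nthOr0-just μ k μk≡x =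
  superstandard-rowStart μ μ-pos k μk≡x ∷
  subst (λ a → All (λ s → Col (superstandard μ) s 0) (stripStarts a (applyDownFrom (nthOr0 μ) k)))
    (sym (cellsFrom-nth μ k μk≡x))
    (superstandard-stripStarts μ μ-pos k (<⇒≤ k<len))

superstandard-rowStripShape : ∀ μ → IsComposition μ → RowStripShape (superstandard μ) (reverse μ)
superstandard-rowStripShape μ μ-pos =
  subst₂ (RowStripsFrom (superstandard μ) _) (cellsFrom-length μ) (applyDownFrom-nthOr0 μ)
    (superstandard-strips μ μ-pos (length μ) ≤-refl)

superstandard-stripsStartLeft : ∀ μ → IsComposition μ → StripsStartLeft (superstandard μ)
superstandard-stripsStartLeft μ μ-pos γ shape =
  subst (λ δ → All (λ s → Col (superstandard μ) s 0) (stripStarts 0 δ))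
    (rowStrips-unique (reverse μ) γ (superstandard-rowStripShape μ μ-pos) shape)
    (subst₂ (λ a δ → All (λ s → Col (superstandard μ) s 0) (stripStarts a δ))
      (cellsFrom-length μ) (applyDownFrom-nthOr0 μ) (superstandard-stripStarts μ μ-pos (length μ) ≤-refl))

superstandard-isDIRT : ∀ μ → IsComposition μ → IsDIRT (superstandard μ)
superstandard-isDIRT μ μ-pos =
  superstandard-rowsIncrease μ , superstandard-stripsStartLeft μ μ-pos ,
  superstandard-firstColumn μ , superstandard-triangle μ

module FirstColumnStrips
  (Q : Filling)
  (entries : concat Q ↭ map suc (upTo (sum (map length Q))))
  (rowsIncrease : RowsIncrease Q)
  (firstColumn : FirstColumnDecreasingUp Q)
  (partition : IsPartition (map length Q))
  where

  n : ℕ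
  n = length (concat Q)

  entry-range : ∀ {i j v} → entry Q i j ≡ just v → 0 < v × v ≤ n
  entry-range e with u , u∈ , refl ← ∈-map⁻ suc (∈-resp-↭ entries (entry⇒∈ Q e)) =
    s≤s z≤n , subst (suc u ≤_) (sym (length-concat Q)) (∈-upTo⁻ u∈)

  entry-surjective : ∀ {v} → 0 < v → v ≤ n → ∃₂ λ i j → entry Q i j ≡ just v
  entry-surjective {suc u} _ v≤n =
    ∈⇒entry Q (∈-resp-↭ (↭-sym entries) (∈-map⁺ suc (∈-upTo⁺ u<N)))
    where
    u<N : u < sum (map length Q)
    u<N = subst (suc u ≤_) (length-concat Q) v≤n

  firstColumn-≤ : ∀ i {j c v} → entry Q 0 j ≡ just c → entry Q i j ≡ just v → c ≤ v
  firstColumn-≤ zero        e e′ = ≤-reflexive (just-injective (trans (sym e) e′))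
  firstColumn-≤ (suc i) {j} e e′ with u , e″ ← left-neighbour Q e′ =
    ≤-trans (firstColumn-≤ i e e″) (<⇒≤ (rowsIncrease i j _ _ e″ e′))

  rowLength-antitone : ∀ {j k} → j ≤ k → rowLength Q k ≤ rowLength Q j
  rowLength-antitone = nthOr0-antitone (proj₂ partition)

  rowLength-pos : ∀ {j} → j < length Q → 0 < rowLength Q j
  rowLength-pos {j} j<len = All-nthOr0 j (proj₁ partition) (subst (j <_) (sym (length-map length Q)) j<len)

  firstColumn-below : ∀ {j j′ c} → j′ < j → entry Q 0 j ≡ just c → ∃ λ c′ → entry Q 0 j′ ≡ just c′
  firstColumn-below j′<j e =
    rowLength-pos⇒entry Q (<-≤-trans (entry⇒<rowLength Q e) (rowLength-antitone (<⇒≤ j′<j)))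

  firstColumn-<⇒above : ∀ {j j′ u w} → entry Q 0 j ≡ just u → entry Q 0 j′ ≡ just w → u < w → j′ < j
  firstColumn-<⇒above {j} {j′} e e′ u<w with <-cmp j′ j
  ... | tri< j′<j _ _ = j′<j
  ... | tri≈ _ refl _ = ⊥-elim (<-irrefl (just-injective (trans (sym e) e′)) u<w)
  ... | tri> _ _ j<j′ = ⊥-elim (<-asym u<w (firstColumn j′ j _ _ j<j′ e′ e))

  strip-below : ∀ {a g j j′ c} → DistinctCols Q a g → entry Q 0 j ≡ just (suc a) →
    j′ < j → entry Q 0 j′ ≡ just c → a + g < c
  strip-below {a} {j = j} {j′} distinct e j′<j e′ =
    ≰⇒> λ c≤a+g → distinct (suc a) _ 0 (n<1+n a) (firstColumn j j′ _ _ j′<j e e′) c≤a+g (j , e) (j′ , e′)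

  strip-columns : ∀ {a g j} → DistinctCols Q a g → entry Q 0 j ≡ just (suc a) → a + g ≤ n →
    ∀ t → t < g → ∃ λ i → i < rowLength Q j × Col Q (suc (a + t)) i
  strip-columns {a} {g} {j} distinct e end≤n t t<g
    with i , j′ , e′ ← entry-surjective (s≤s z≤n) (≤-trans (+-monoʳ-< a t<g) end≤n)
    with j ≤? j′
  ... | yes j≤j′ = i , <-≤-trans (entry⇒<rowLength Q e′) (rowLength-antitone j≤j′) , j′ , e′
  ... | no j≰j′ with c , ec ← firstColumn-below (≰⇒> j≰j′) e =
    ⊥-elim (<⇒≱ (strip-below distinct e (≰⇒> j≰j′) ec)
                (≤-trans (firstColumn-≤ i ec e′) (+-monoʳ-< a t<g)))

  strip-length≤rowLength : ∀ {a g j} → DistinctCols Q a g → entry Q 0 j ≡ just (suc a) → a + g ≤ n →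
    g ≤ rowLength Q j
  strip-length≤rowLength {a} distinct e end≤n =
    pigeonhole-≤ (λ t i → Col Q (suc (a + t)) i) (strip-columns distinct e end≤n)
      (λ s t i s<t t<g → distinct (suc (a + s)) (suc (a + t)) i
                            (s≤s (m≤m+n a s)) (s≤s (+-monoʳ-< a s<t)) (+-monoʳ-< a t<g))

  last-strip-in-bottom-row : ∀ {a g j} → DistinctCols Q a g → entry Q 0 j ≡ just (suc a) →
    a + g ≡ n → j ≡ 0
  last-strip-in-bottom-row {j = zero}  _        _ _      = refl
  last-strip-in-bottom-row {j = suc j} distinct e end≡n with c , ec ← firstColumn-below (n<1+n j) e =
    ⊥-elim (<⇒≱ (strip-below distinct e (n<1+n j) ec)
                (subst (_ ≤_) (sym end≡n) (proj₂ (entry-range ec))))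

  next-strip-one-row-down : ∀ {a g j j₂} → 0 < g → DistinctCols Q a g →
    entry Q 0 j ≡ just (suc a) → entry Q 0 j₂ ≡ just (suc (a + g)) → j ≡ suc j₂
  next-strip-one-row-down {a} 0<g distinct e e₂ with firstColumn-<⇒above e e₂ (s≤s (m<m+n a 0<g))
  ... | s≤s {n = j} j₂≤j with m≤n⇒m<n∨m≡n j₂≤j
  ...   | inj₂ refl = refl
  ...   | inj₁ j₂<j with c , ec ← firstColumn-below (n<1+n j) e =
    ⊥-elim (<⇒≱ (strip-below distinct e (n<1+n j) ec) (≤-pred (firstColumn j _ c _ j₂<j ec e₂)))

  strips-≤-rowLengths : ∀ γ {a j} → RowStripsFrom Q n a γ → All (λ s → Col Q s 0) (stripStarts a γ) →
    entry Q 0 j ≡ just (suc a) → Pointwise _≤_ γ (applyDownFrom (rowLength Q) (suc j))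
  strips-≤-rowLengths [] a≡n _ e = ⊥-elim (<-irrefl a≡n (proj₂ (entry-range e)))
  strips-≤-rowLengths (g ∷ []) (_ , distinct , _ , end≡n) _ e
    with refl ← last-strip-in-bottom-row distinct e end≡n
    = strip-length≤rowLength distinct e (≤-reflexive end≡n) ∷ []
  strips-≤-rowLengths (g ∷ g′ ∷ γ) (0<g , distinct , _ , rest) (_ ∷ starts@((_ , e₂) ∷ _)) e
    with refl ← next-strip-one-row-down 0<g distinct e e₂
    = strip-length≤rowLength distinct e (rowStrips-start-≤ (g′ ∷ γ) rest)
    ∷ strips-≤-rowLengths (g′ ∷ γ) rest starts e₂

  first-strip-in-top-row : ∀ {j} → entry Q 0 j ≡ just 1 → length Q ≡ suc j
  first-strip-in-top-row {j} e
    with r , Qj≡r , _ ← entry⇒nth Q e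
    with m≤n⇒m<n∨m≡n (nth-just⇒< Q j Qj≡r)
  ... | inj₂ top = sym top
  ... | inj₁ j+1<len
    with c , ec ← rowLength-pos⇒entry Q (rowLength-pos j+1<len)
    = ⊥-elim (<⇒≱ (firstColumn (suc j) j c 1 (n<1+n j) ec e) (proj₁ (entry-range ec)))

  rowStripShape-reverse : ∀ γ → RowStripShape Q γ → All (λ s → Col Q s 0) (stripStarts 0 γ) →
    γ ≡ reverse (map length Q)
  rowStripShape-reverse [] 0≡n _ =
    cong reverse (sym (sum≡0⇒[] (proj₁ partition) (trans (sym (length-concat Q)) (sym 0≡n))))
  rowStripShape-reverse γ@(_ ∷ _) shape starts@((_ , e) ∷ _) = Pointwise-≤∧sum-≡⇒≡ γ≤rows sums
    where
    γ≤rows : Pointwise _≤_ γ (reverse (map length Q))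
    γ≤rows = subst (Pointwise _≤_ γ)
      (trans (cong (applyDownFrom (rowLength Q)) (sym (first-strip-in-top-row e))) (rowLengths-downward Q))
      (strips-≤-rowLengths γ shape starts e)
    sums : sum γ ≡ sum (reverse (map length Q))
    sums = begin
      sum γ                        ≡⟨ rowStrips-sum γ shape ⟩
      length (concat Q)            ≡⟨ length-concat Q ⟩
      sum (map length Q)           ≡⟨ sum-↭ (↭-reverse (map length Q)) ⟨
      sum (reverse (map length Q)) ∎
      where open ≡-Reasoning

mainTheorem13 : (μ α : List ℕ) → IsPartition μ → IsComposition α →
    (∃ λ Q → IsFillingOf μ Q × IsDIRT Q × RowStripShape Q (reverse α)) ⇔ (α ≡ μ)
mainTheorem13 μ α μ-partition _ = mk⇔ dirt⇒α≡μ α≡μ⇒dirt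
  where
  dirt⇒α≡μ : (∃ λ Q → IsFillingOf μ Q × IsDIRT Q × RowStripShape Q (reverse α)) → α ≡ μ
  dirt⇒α≡μ (Q , (refl , entries) , (rowsIncrease , startsLeft , firstColumn , _) , shape) =
    reverse-injective (FirstColumnStrips.rowStripShape-reverse Q entries rowsIncrease firstColumn μ-partition
      (reverse α) shape (startsLeft (reverse α) shape))
  α≡μ⇒dirt : α ≡ μ → ∃ λ Q → IsFillingOf μ Q × IsDIRT Q × RowStripShape Q (reverse α)
  α≡μ⇒dirt refl = superstandard μ , (map-length-superstandard μ , concat-superstandard μ) ,
    superstandard-isDIRT μ (proj₁ μ-partition) , superstandard-rowStripShape μ (proj₁ μ-partition)
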